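{- For every finite simple graph $G$ with at least one vertex, $$\alpha_1(G)\geq Z_2(G)=\sum_{v\in V(G)}\min\left\{1,\frac{1}{\zeta(v)+\frac12}\right\}.$$
   Context: For an integer $k\geq 0$, a $k$-independent set of $G$ is a set $S\subseteq V(G)$ with $\Delta(G[S])\leq k$, and $\alpha_k(G)$ is the maximum cardinality of a $k$-independent set. For a vertex $v$, $\zeta(v)=\max_H\delta(H)$, the maximum over all subgraphs $H$ of $G$ containing $v$, where $\delta(H)$ is the minimum degree (isolated vertices have $\zeta=0$). -}

module Defs where

open import Data.Nat as ℕ using (ℕ; zero; suc; _≤_)
open import Data.Bool using (Bool; true; false; if_then_else_; _∧_; T)
open import Data.Fin using (Fin)
open import Data.List using (List; map; foldr; allFin)
open import Data.Product using (Σ; _×_; ∃)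
open import Data.Integer using (+_)
open import Data.Rational as ℚ using (ℚ; _/_; _⊓_; 0ℚ; 1ℚ)
open import Relation.Binary.PropositionalEquality using (_≡_)

record Graph (n : ℕ) : Set where
  field
    adj    : Fin n → Fin n → Bool
    sym    : ∀ u w → adj u w ≡ adj w u
    irrefl : ∀ u → adj u u ≡ false
open Graph public

count : {n : ℕ} → (Fin n → Bool) → ℕ
count {n} f = foldr ℕ._+_ 0 (map (λ i → if f i then 1 else 0) (allFin n))

-- A (not necessarily induced) subgraph H of G: vertex set and edge set,
-- with every edge of H an edge of G joining two vertices of H.
record Subgraph {n : ℕ} (G : Graph n) : Set where
  field
    inV  : Fin n → Bool
    inE  : Fin n → Fin n → Bool
    Esym : ∀ u w → inE u w ≡ inE w u
    E⊆   : ∀ u w → T (inE u w) → T (adj G u w) × T (inV u) × T (inV w)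
open Subgraph public

degH : {n : ℕ} {G : Graph n} → Subgraph G → Fin n → ℕ
degH H u = count (λ w → inE H u w)

MinDeg : {n : ℕ} {G : Graph n} → Subgraph G → ℕ → Set
MinDeg H d = (Σ (Fin _) λ u → T (inV H u) × degH H u ≡ d)
           × (∀ u → T (inV H u) → d ≤ degH H u)

IsZeta : {n : ℕ} → Graph n → Fin n → ℕ → Set
IsZeta G v z = (Σ (Subgraph G) λ H → T (inV H v) × MinDeg H z)
             × (∀ (H : Subgraph G) d → T (inV H v) → MinDeg H d → d ≤ z)

KIndependent : {n : ℕ} → Graph n → ℕ → (Fin n → Bool) → Set
KIndependent G k S = ∀ u → T (S u) → count (λ w → S w ∧ adj G u w) ≤ k

-- min{1, 1/(z + 1/2)}, written as min{1, 2/(2z+1)}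
zterm : ℕ → ℚ
zterm z = 1ℚ ⊓ (+ 2 / suc (2 ℕ.* z))

Z2 : {n : ℕ} → (Fin n → ℕ) → ℚ
Z2 {n} ζ = foldr ℚ._+_ 0ℚ (map (λ v → zterm (ζ v)) (allFin n))

-- In the remaining vertex set W choose a 1-independent S and a set X ⊇ S ∪ N_W(S)
-- whose weight Σ_{x ∈ X} min{1, 1/(ζ(x) + 1/2)} is at most |S|; put S into the solution and delete X.
-- Nothing chosen later is adjacent to S, so the union stays 1-independent. Of ζ only one property is
-- used: every nonempty W contains a vertex whose degree in G[W] is at most ζ(u) for all u ∈ W, since
-- G[W] is a subgraph containing u. S is one vertex (X its closed neighbourhood) or two (X the union).
-- With m the minimum of ζ on W, a vertex of degree < m, two vertices of minimum degree at distance
-- at most 2, or one with a neighbour of degree at most m + 1 give S directly. Otherwise deleting the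
-- minimum-degree vertices leaves minimum degree at least m + 1, so ζ ≥ m + 1 on the neighbours of a
-- minimum-degree vertex v and S = {v} is affordable, except when m = 1 and the new minimum degree is
-- exactly 2; that case is handled by repeating the argument on the vertices of degree at most 2.

module Submission where

open import Defs renaming (sym to adj-sym)
open import Data.Nat as ℕ using (ℕ; zero; suc; _+_; _*_; _≤_; z≤n; s≤s; _≤ᵇ_)
import Data.Nat.Properties as ℕₚ
import Data.Bool.Properties as Boolₚ
open import Data.Bool.Properties using (T-∧; T-∨; T-≡)
open import Function.Bundles using (module Equivalence)
open Equivalence using (to; from)
open import Data.Nat.Tactic.RingSolver using (solve-∀)
open import Data.Bool using (Bool; true; false; if_then_else_; _∧_; _∨_; not; T)
open import Data.Fin using (Fin; zero; suc; _≟_)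
open import Data.Fin.Properties using (any?)
import Data.List as List
import Data.List.Properties as Listₚ
import Data.Vec.Functional as Vector
open import Data.Product using (Σ; ∃; ∃₂; _×_; _,_; proj₁; proj₂)
open import Data.Sum using (_⊎_; inj₁; inj₂; [_,_]′)
open import Data.Empty using (⊥-elim)
open import Data.Unit using (tt)
open import Function using (_∘_; id; flip)
open import Relation.Nullary using (¬_; Dec; yes; no; contradiction)
open import Relation.Nullary.Decidable using (⌊_⌋; T?; _×-dec_; ¬?)
open import Data.Integer as ℤ using (+_)
import Data.Integer.Properties as ℤₚ
open import Data.Rational as ℚ using (ℚ; _/_; 0ℚ; 1ℚ; toℚᵘ)
import Data.Rational.Properties as ℚₚ
open import Data.Rational.Unnormalised as ℚᵘ using (mkℚᵘ; *≡*; *≤*)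
import Data.Rational.Unnormalised.Properties as ℚᵘₚ
import Algebra.Properties.CommutativeMonoid.Sum as Sum
open import Relation.Binary.PropositionalEquality

-- Vertex sets as Boolean predicates

module _ {n : ℕ} where

  infix  4 _∈_ _∉_ _⊆_
  infixr 7 _∩_
  infixr 6 _∪_ _─_

  _∈_ : Fin n → (Fin n → Bool) → Set
  x ∈ P = T (P x)

  _∉_ : Fin n → (Fin n → Bool) → Set
  x ∉ P = ¬ x ∈ P

  _⊆_ : (Fin n → Bool) → (Fin n → Bool) → Set
  P ⊆ Q = ∀ {x} → x ∈ P → x ∈ Q

  Nonempty : (Fin n → Bool) → Set
  Nonempty P = ∃ λ x → x ∈ P

  nonempty? : ∀ P → Dec (Nonempty P)
  nonempty? P = any? (λ x → T? (P x))

  -- Opaque, so that unification recovers P and Q from x ∈ P ∩ Q instead of getting stuck on P x ∧ Q x.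
  opaque
    _∩_ _∪_ _─_ : (Fin n → Bool) → (Fin n → Bool) → Fin n → Bool
    (P ∩ Q) x = P x ∧ Q x
    (P ∪ Q) x = P x ∨ Q x
    (P ─ Q) x = P x ∧ not (Q x)

    ⁅_⁆ : Fin n → Fin n → Bool
    ⁅ x ⁆ y = ⌊ y ≟ x ⌋

  opaque
    unfolding _∩_

    ∩-apply : ∀ P Q x → (P ∩ Q) x ≡ P x ∧ Q x
    ∩-apply _ _ _ = refl

    ∈∩⁺ : ∀ {P Q x} → x ∈ P → x ∈ Q → x ∈ P ∩ Q
    ∈∩⁺ {P} {x = x} x∈P x∈Q = from (T-∧ {P x}) (x∈P , x∈Q)

    ∈∩⁻ˡ : ∀ {P Q x} → x ∈ P ∩ Q → x ∈ P
    ∈∩⁻ˡ {P} {x = x} = proj₁ ∘ to (T-∧ {P x})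

    ∈∩⁻ʳ : ∀ {P Q x} → x ∈ P ∩ Q → x ∈ Q
    ∈∩⁻ʳ {P} {x = x} = proj₂ ∘ to (T-∧ {P x})

    ∈∪⁺ˡ : ∀ {P Q x} → x ∈ P → x ∈ P ∪ Q
    ∈∪⁺ˡ {P} {x = x} = from (T-∨ {P x}) ∘ inj₁

    ∈∪⁺ʳ : ∀ {P Q x} → x ∈ Q → x ∈ P ∪ Q
    ∈∪⁺ʳ {P} {x = x} = from (T-∨ {P x}) ∘ inj₂

    ∈∪⁻ : ∀ {P Q x} → x ∈ P ∪ Q → x ∈ P ⊎ x ∈ Q
    ∈∪⁻ {P} {x = x} = to (T-∨ {P x})

    ∈─⁺ : ∀ {P Q x} → x ∈ P → x ∉ Q → x ∈ P ─ Q
    ∈─⁺ {P} {Q} {x} x∈P x∉Q with Q x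
    ... | false = from (T-∧ {P x}) (x∈P , tt)
    ... | true = contradiction tt x∉Q

    ∈─⁻ˡ : ∀ {P Q x} → x ∈ P ─ Q → x ∈ P
    ∈─⁻ˡ {P} {x = x} = proj₁ ∘ to (T-∧ {P x})

    ∈─⁻ʳ : ∀ {P Q x} → x ∈ P ─ Q → x ∉ Q
    ∈─⁻ʳ {P} {Q} {x} x∈P─Q with Q x
    ... | false = λ ()
    ... | true = λ _ → proj₂ (to (T-∧ {P x}) x∈P─Q)

    x∈⁅x⁆ : ∀ x → x ∈ ⁅ x ⁆
    x∈⁅x⁆ x with x ≟ x
    ... | yes _ = tt
    ... | no x≢x = x≢x refl

    x∈⁅y⁆⇒x≡y : ∀ {x y} → x ∈ ⁅ y ⁆ → x ≡ y
    x∈⁅y⁆⇒x≡y {x} {y} p with x ≟ y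
    ... | yes x≡y = x≡y

-- Cardinality and weight

module ℕΣ = Sum ℕₚ.+-0-commutativeMonoid
module ℚΣ = Sum ℚₚ.+-0-commutativeMonoid

⟦_⟧ : Bool → ℕ
⟦ b ⟧ = if b then 1 else 0

foldr-map-allFin : ∀ {A : Set} (_∙_ : A → A → A) (e : A) {n} (f : Fin n → A) →
                   List.foldr _∙_ e (List.map f (List.allFin n)) ≡ Vector.foldr _∙_ e f
foldr-map-allFin _∙_ e {n} f =
  trans (cong (List.foldr _∙_ e) (Listₚ.map-tabulate id f)) (foldr-tabulate f)
  where
  foldr-tabulate : ∀ {m} (g : Fin m → _) → List.foldr _∙_ e (List.tabulate g) ≡ Vector.foldr _∙_ e g
  foldr-tabulate {zero} g = refl
  foldr-tabulate {suc m} g = cong (g zero ∙_) (foldr-tabulate (g ∘ suc))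

-- Opaque for the same reason: P is then inferred from goals such as ∣ P ∣ ≤ ∣ Q ∣.
opaque
  ∣_∣ : ∀ {n} → (Fin n → Bool) → ℕ
  ∣ P ∣ = ℕΣ.sum (λ x → ⟦ P x ⟧)

opaque
  unfolding ∣_∣ _∩_

  count≡∣∣ : ∀ {n} (P : Fin n → Bool) → count P ≡ ∣ P ∣
  count≡∣∣ P = foldr-map-allFin _+_ 0 (λ x → ⟦ P x ⟧)

  ∣∣-cong : ∀ {n} {P Q : Fin n → Bool} → (∀ x → P x ≡ Q x) → ∣ P ∣ ≡ ∣ Q ∣
  ∣∣-cong P≗Q = ℕΣ.sum-cong-≗ (cong ⟦_⟧ ∘ P≗Q)

  ∣∣-mono : ∀ {n} {P Q : Fin n → Bool} → P ⊆ Q → ∣ P ∣ ≤ ∣ Q ∣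
  ∣∣-mono {zero} _ = z≤n
  ∣∣-mono {suc n} {P} {Q} P⊆Q =
    ℕₚ.+-mono-≤ (head-mono (P zero) (Q zero) P⊆Q) (∣∣-mono {n} {P ∘ suc} {Q ∘ suc} P⊆Q)
    where
    head-mono : ∀ a b → (T a → T b) → ⟦ a ⟧ ≤ ⟦ b ⟧
    head-mono false _ _ = z≤n
    head-mono true true _ = ℕₚ.≤-refl
    head-mono true false a⇒b = ⊥-elim (a⇒b tt)

  ∣∪∣+∣∩∣ : ∀ {n} (P Q : Fin n → Bool) → ∣ P ∪ Q ∣ + ∣ P ∩ Q ∣ ≡ ∣ P ∣ + ∣ Q ∣
  ∣∪∣+∣∩∣ P Q = begin
    ∣ P ∪ Q ∣ + ∣ P ∩ Q ∣
      ≡⟨ ℕΣ.∑-distrib-+ (λ x → ⟦ (P ∪ Q) x ⟧) (λ x → ⟦ (P ∩ Q) x ⟧) ⟨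
    ℕΣ.sum (λ x → ⟦ P x ∨ Q x ⟧ + ⟦ P x ∧ Q x ⟧)   ≡⟨ ℕΣ.sum-cong-≗ (λ x → pointwise (P x) (Q x)) ⟩
    ℕΣ.sum (λ x → ⟦ P x ⟧ + ⟦ Q x ⟧)               ≡⟨ ℕΣ.∑-distrib-+ (λ x → ⟦ P x ⟧) (λ x → ⟦ Q x ⟧) ⟩
    ∣ P ∣ + ∣ Q ∣                                  ∎
    where
    open ≡-Reasoning
    pointwise : ∀ a b → ⟦ a ∨ b ⟧ + ⟦ a ∧ b ⟧ ≡ ⟦ a ⟧ + ⟦ b ⟧
    pointwise true true = refl
    pointwise true false = refl
    pointwise false b = ℕₚ.+-identityʳ ⟦ b ⟧

  ∣∣≡∣∩∣+∣─∣ : ∀ {n} (P Q : Fin n → Bool) → ∣ P ∣ ≡ ∣ P ∩ Q ∣ + ∣ P ─ Q ∣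
  ∣∣≡∣∩∣+∣─∣ P Q = trans (ℕΣ.sum-cong-≗ (λ x → pointwise (P x) (Q x)))
                        (ℕΣ.∑-distrib-+ (λ x → ⟦ (P ∩ Q) x ⟧) (λ x → ⟦ (P ─ Q) x ⟧))
    where
    pointwise : ∀ a b → ⟦ a ⟧ ≡ ⟦ a ∧ b ⟧ + ⟦ a ∧ not b ⟧
    pointwise true true = refl
    pointwise true false = refl
    pointwise false b = refl

  ∣∣≡0 : ∀ {n} {P : Fin n → Bool} → (∀ x → x ∉ P) → ∣ P ∣ ≡ 0
  ∣∣≡0 {zero} _ = refl
  ∣∣≡0 {suc n} {P} none with P zero | none zero
  ... | false | _ = ∣∣≡0 {n} {P ∘ suc} (none ∘ suc)
  ... | true | ¬⊤ = ⊥-elim (¬⊤ tt)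

  ∣⁅x⁆∣≡1 : ∀ {n} (x : Fin n) → ∣ ⁅ x ⁆ ∣ ≡ 1
  ∣⁅x⁆∣≡1 {suc n} zero = cong suc (∣∣≡0 {n} {⁅ zero ⁆ ∘ suc} (λ _ ()))
  ∣⁅x⁆∣≡1 {suc n} (suc x) = trans (∣∣-cong {n} {⁅ suc x ⁆ ∘ suc} shift) (∣⁅x⁆∣≡1 x)
    where
    shift : ∀ y → ⌊ suc y ≟ suc x ⌋ ≡ ⌊ y ≟ x ⌋
    shift y with y ≟ x
    ... | yes _ = refl
    ... | no _ = refl

∣∪∣-disjoint : ∀ {n} {P Q : Fin n → Bool} → (∀ {x} → x ∈ P → x ∉ Q) → ∣ P ∪ Q ∣ ≡ ∣ P ∣ + ∣ Q ∣
∣∪∣-disjoint {P = P} {Q} disjoint = begin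
  ∣ P ∪ Q ∣              ≡⟨ ℕₚ.+-identityʳ _ ⟨
  ∣ P ∪ Q ∣ + 0          ≡⟨ cong (λ k → ∣ P ∪ Q ∣ + k) (∣∣≡0 (λ x p → disjoint (∈∩⁻ˡ p) (∈∩⁻ʳ p))) ⟨
  ∣ P ∪ Q ∣ + ∣ P ∩ Q ∣  ≡⟨ ∣∪∣+∣∩∣ P Q ⟩
  ∣ P ∣ + ∣ Q ∣          ∎
  where open ≡-Reasoning

∣⁅x⁆∪⁅y⁆∣≡2 : ∀ {n} {x y : Fin n} → x ≢ y → ∣ ⁅ x ⁆ ∪ ⁅ y ⁆ ∣ ≡ 2
∣⁅x⁆∪⁅y⁆∣≡2 {x = x} {y} x≢y =
  trans (∣∪∣-disjoint (λ {z} z∈⁅x⁆ z∈⁅y⁆ → x≢y (trans (sym (x∈⁅y⁆⇒x≡y z∈⁅x⁆)) (x∈⁅y⁆⇒x≡y z∈⁅y⁆))))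
        (cong₂ _+_ (∣⁅x⁆∣≡1 x) (∣⁅x⁆∣≡1 y))

⊆⁅x⁆⇒∣∣≤1 : ∀ {n} {P : Fin n → Bool} {x} → P ⊆ ⁅ x ⁆ → ∣ P ∣ ≤ 1
⊆⁅x⁆⇒∣∣≤1 {x = x} P⊆⁅x⁆ = ℕₚ.≤-trans (∣∣-mono P⊆⁅x⁆) (ℕₚ.≤-reflexive (∣⁅x⁆∣≡1 x))

∈⇒1≤∣∣ : ∀ {n} {P : Fin n → Bool} {x} → x ∈ P → 1 ≤ ∣ P ∣
∈⇒1≤∣∣ {P = P} {x} x∈P = subst (_≤ ∣ P ∣) (∣⁅x⁆∣≡1 x)
  (∣∣-mono (λ {y} y∈⁅x⁆ → subst (_∈ P) (sym (x∈⁅y⁆⇒x≡y y∈⁅x⁆)) x∈P))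

∈⇒2≤∣∣ : ∀ {n} {P : Fin n → Bool} {x y} → x ≢ y → x ∈ P → y ∈ P → 2 ≤ ∣ P ∣
∈⇒2≤∣∣ {P = P} {x} {y} x≢y x∈P y∈P = subst (_≤ ∣ P ∣) (∣⁅x⁆∪⁅y⁆∣≡2 x≢y) (∣∣-mono pair⊆P)
  where
  pair⊆P : ⁅ x ⁆ ∪ ⁅ y ⁆ ⊆ P
  pair⊆P p with ∈∪⁻ p
  ... | inj₁ z∈⁅x⁆ = subst (_∈ P) (sym (x∈⁅y⁆⇒x≡y z∈⁅x⁆)) x∈P
  ... | inj₂ z∈⁅y⁆ = subst (_∈ P) (sym (x∈⁅y⁆⇒x≡y z∈⁅y⁆)) y∈P

∣∣≤1⇒≡ : ∀ {n} {P : Fin n → Bool} {x y} → ∣ P ∣ ≤ 1 → x ∈ P → y ∈ P → x ≡ y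
∣∣≤1⇒≡ {x = x} {y} ∣P∣≤1 x∈P y∈P with x ≟ y
... | yes x≡y = x≡y
... | no x≢y = contradiction (ℕₚ.≤-trans (∈⇒2≤∣∣ x≢y x∈P y∈P) ∣P∣≤1) (λ { (s≤s ()) })

members-equal⇒∣∣≤1 : ∀ {n} {P : Fin n → Bool} → (∀ {x y} → x ∈ P → y ∈ P → x ≡ y) → ∣ P ∣ ≤ 1
members-equal⇒∣∣≤1 {P = P} all-equal with nonempty? P
... | yes (x , x∈P) = ⊆⁅x⁆⇒∣∣≤1 (λ y∈P → subst (_∈ ⁅ x ⁆) (all-equal x∈P y∈P) (x∈⁅x⁆ x))
... | no empty = ℕₚ.≤-trans (ℕₚ.≤-reflexive (∣∣≡0 (λ x x∈P → empty (x , x∈P)))) z≤n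

1≤∣∣⇒Nonempty : ∀ {n} {P : Fin n → Bool} → 1 ≤ ∣ P ∣ → Nonempty P
1≤∣∣⇒Nonempty {P = P} 1≤∣P∣ with nonempty? P
... | yes ne = ne
... | no empty = contradiction (ℕₚ.≤-trans 1≤∣P∣ (ℕₚ.≤-reflexive (∣∣≡0 (λ x x∈P → empty (x , x∈P))))) (λ ())

argmin : ∀ {n} (f : Fin n → ℕ) {W : Fin n → Bool} → Nonempty W →
         ∃ λ x → x ∈ W × ∀ {y} → y ∈ W → f x ≤ f y
argmin {suc n} f {W} _ with nonempty? (W ∘ suc)
argmin {suc n} f {W} (zero , 0∈W) | no none =
  zero , 0∈W , λ { {zero} _ → ℕₚ.≤-refl ; {suc y} y∈W → contradiction (y , y∈W) none }
argmin {suc n} f {W} (suc x , x∈W) | no none = contradiction (x , x∈W) none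
argmin {suc n} f {W} _ | yes ne with argmin (f ∘ suc) {W ∘ suc} ne
... | x , x∈W , x-min with T? (W zero)
...   | no 0∉W = suc x , x∈W , λ { {zero} 0∈W → contradiction 0∈W 0∉W ; {suc y} y∈W → x-min y∈W }
...   | yes 0∈W with f zero ℕ.≤? f (suc x)
...     | yes f0≤ = zero , 0∈W , λ { {zero} _ → ℕₚ.≤-refl ; {suc y} y∈W → ℕₚ.≤-trans f0≤ (x-min y∈W) }
...     | no f0≰ = suc x , x∈W , λ { {zero} _ → ℕₚ.<⇒≤ (ℕₚ.≰⇒> f0≰) ; {suc y} y∈W → x-min y∈W }

_/1 : ℕ → ℚ
k /1 = + k / 1

-- ρ j = 1/(j + 1/2), so that zterm z = min{1, ρ z}.
ρ : ℕ → ℚ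
ρ j = + 2 / suc (2 * j)

zterm≤1 : ∀ z → zterm z ℚ.≤ 1ℚ
zterm≤1 z = ℚₚ.p⊓q≤p 1ℚ (ρ z)

ρ-antitone : ∀ {j z} → j ≤ z → ρ z ℚ.≤ ρ j
ρ-antitone {j} {z} j≤z = ℚₚ.toℚᵘ-cancel-≤
  (ℚᵘₚ.≤-respˡ-≃ (ℚᵘₚ.≃-sym (ℚₚ.toℚᵘ-fromℚᵘ (mkℚᵘ (+ 2) (2 * z))))
  (ℚᵘₚ.≤-respʳ-≃ (ℚᵘₚ.≃-sym (ℚₚ.toℚᵘ-fromℚᵘ (mkℚᵘ (+ 2) (2 * j))))
  (*≤* (subst₂ ℤ._≤_ (ℤₚ.pos-* 2 (suc (2 * j))) (ℤₚ.pos-* 2 (suc (2 * z)))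
                    (ℤ.+≤+ (ℕₚ.*-monoʳ-≤ 2 (s≤s (ℕₚ.*-monoʳ-≤ 2 j≤z))))))))

zterm≤ρ : ∀ {j z} → j ≤ z → zterm z ℚ.≤ ρ j
zterm≤ρ {j} {z} j≤z = ℚₚ.≤-trans (ℚₚ.p⊓q≤q 1ℚ (ρ z)) (ρ-antitone j≤z)

/1-+ : ∀ a b → (a + b) /1 ≡ a /1 ℚ.+ b /1
/1-+ a b = ℚₚ.toℚᵘ-injective (ℚᵘₚ.≃-trans (ℚₚ.toℚᵘ-fromℚᵘ (mkℚᵘ (+ (a + b)) 0))
  (ℚᵘₚ.≃-trans (*≡* eq) (ℚᵘₚ.≃-sym (ℚᵘₚ.≃-trans (ℚₚ.toℚᵘ-homo-+ (a /1) (b /1))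
    (ℚᵘₚ.+-cong (ℚₚ.toℚᵘ-fromℚᵘ (mkℚᵘ (+ a) 0)) (ℚₚ.toℚᵘ-fromℚᵘ (mkℚᵘ (+ b) 0)))))))
  where
  eq : + (a + b) ℤ.* + 1 ≡ (+ a ℤ.* + 1 ℤ.+ + b ℤ.* + 1) ℤ.* + 1
  eq = trans (ℤₚ.*-identityʳ _) (sym (trans (ℤₚ.*-identityʳ _)
         (trans (cong₂ ℤ._+_ (ℤₚ.*-identityʳ (+ a)) (ℤₚ.*-identityʳ (+ b))) (sym (ℤₚ.pos-+ a b)))))

toℚᵘ-/1*ρ : ∀ k j → toℚᵘ (k /1 ℚ.* ρ j) ℚᵘ.≃ mkℚᵘ (+ (k * 2)) (2 * j)
toℚᵘ-/1*ρ k j = ℚᵘₚ.≃-trans (ℚₚ.toℚᵘ-homo-* (k /1) (ρ j))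
  (ℚᵘₚ.≃-trans (ℚᵘₚ.*-cong (ℚₚ.toℚᵘ-fromℚᵘ (mkℚᵘ (+ k) 0)) (ℚₚ.toℚᵘ-fromℚᵘ (mkℚᵘ (+ 2) (2 * j))))
    (*≡* (trans (cong (ℤ._* + suc (2 * j)) (sym (ℤₚ.pos-* k 2)))
                (cong (λ d → + (k * 2) ℤ.* + suc d) (sym (ℕₚ.+-identityʳ (2 * j)))))))

mkℚᵘ-≤-/1 : ∀ a b N → a ≤ N * suc b → mkℚᵘ (+ a) b ℚᵘ.≤ mkℚᵘ (+ N) 0
mkℚᵘ-≤-/1 a b N a≤ = *≤* (subst₂ ℤ._≤_ (sym (ℤₚ.*-identityʳ (+ a))) (ℤₚ.pos-* N (suc b)) (ℤ.+≤+ a≤))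

mkℚᵘ-+-≤-/1 : ∀ a b c d N → a * suc d + c * suc b ≤ N * (suc b * suc d) →
              mkℚᵘ (+ a) b ℚᵘ.+ mkℚᵘ (+ c) d ℚᵘ.≤ mkℚᵘ (+ N) 0
mkℚᵘ-+-≤-/1 a b c d N sum≤ = *≤* (subst₂ ℤ._≤_ (sym numerator) (ℤₚ.pos-* N (suc b * suc d)) (ℤ.+≤+ sum≤))
  where
  numerator : (+ a ℤ.* + suc d ℤ.+ + c ℤ.* + suc b) ℤ.* + 1 ≡ + (a * suc d + c * suc b)
  numerator = trans (ℤₚ.*-identityʳ _)
    (trans (cong₂ ℤ._+_ (sym (ℤₚ.pos-* a (suc d))) (sym (ℤₚ.pos-* c (suc b))))
           (sym (ℤₚ.pos-+ (a * suc d) (c * suc b))))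

/1*ρ-≤ : ∀ {k j N} → k * 2 ≤ N * suc (2 * j) → k /1 ℚ.* ρ j ℚ.≤ N /1
/1*ρ-≤ {k} {j} {N} h = ℚₚ.toℚᵘ-cancel-≤
  (ℚᵘₚ.≤-respˡ-≃ (ℚᵘₚ.≃-sym (toℚᵘ-/1*ρ k j))
  (ℚᵘₚ.≤-respʳ-≃ (ℚᵘₚ.≃-sym (ℚₚ.toℚᵘ-fromℚᵘ (mkℚᵘ (+ N) 0)))
  (mkℚᵘ-≤-/1 (k * 2) (2 * j) N h)))

/1*ρ+/1*ρ-≤ : ∀ {k₁ j₁ k₂ j₂ N} →
              k₁ * 2 * suc (2 * j₂) + k₂ * 2 * suc (2 * j₁) ≤ N * (suc (2 * j₁) * suc (2 * j₂)) →
              k₁ /1 ℚ.* ρ j₁ ℚ.+ k₂ /1 ℚ.* ρ j₂ ℚ.≤ N /1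
/1*ρ+/1*ρ-≤ {k₁} {j₁} {k₂} {j₂} {N} h = ℚₚ.toℚᵘ-cancel-≤
  (ℚᵘₚ.≤-respˡ-≃ (ℚᵘₚ.≃-sym (ℚᵘₚ.≃-trans (ℚₚ.toℚᵘ-homo-+ (k₁ /1 ℚ.* ρ j₁) (k₂ /1 ℚ.* ρ j₂))
                                          (ℚᵘₚ.+-cong (toℚᵘ-/1*ρ k₁ j₁) (toℚᵘ-/1*ρ k₂ j₂))))
  (ℚᵘₚ.≤-respʳ-≃ (ℚᵘₚ.≃-sym (ℚₚ.toℚᵘ-fromℚᵘ (mkℚᵘ (+ N) 0)))
  (mkℚᵘ-+-≤-/1 (k₁ * 2) (2 * j₁) (k₂ * 2) (2 * j₂) N h)))

opaque
  weight : ∀ {n} → (Fin n → ℕ) → (Fin n → Bool) → ℚ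
  weight c X = ℚΣ.sum (λ y → if X y then zterm (c y) else 0ℚ)

opaque
  unfolding weight _∩_

  Z2≡weight : ∀ {n} (ζ : Fin n → ℕ) → Z2 ζ ≡ weight ζ (λ _ → true)
  Z2≡weight ζ = foldr-map-allFin ℚ._+_ 0ℚ (λ v → zterm (ζ v))

  weight-cong : ∀ {n} (c : Fin n → ℕ) {X Y : Fin n → Bool} → (∀ y → X y ≡ Y y) → weight c X ≡ weight c Y
  weight-cong c X≗Y = ℚΣ.sum-cong-≗ (λ y → cong (λ b → if b then zterm (c y) else 0ℚ) (X≗Y y))

  weight-split : ∀ {n} (c : Fin n → ℕ) (W P : Fin n → Bool) →
                 weight c W ≡ weight c (W ∩ P) ℚ.+ weight c (W ─ P)
  weight-split c W P =
    trans (ℚΣ.sum-cong-≗ (λ y → pointwise (W y) (P y) (zterm (c y))))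
          (ℚΣ.∑-distrib-+ (λ y → if (W ∩ P) y then zterm (c y) else 0ℚ)
                          (λ y → if (W ─ P) y then zterm (c y) else 0ℚ))
    where
    pointwise : ∀ a b q → (if a then q else 0ℚ) ≡ (if a ∧ b then q else 0ℚ) ℚ.+ (if a ∧ not b then q else 0ℚ)
    pointwise true true q = sym (ℚₚ.+-identityʳ q)
    pointwise true false q = sym (ℚₚ.+-identityˡ q)
    pointwise false b q = refl

  weight-∅ : ∀ {n} (c : Fin n → ℕ) {W : Fin n → Bool} → (∀ y → y ∉ W) → weight c W ≡ 0ℚ
  weight-∅ {zero} c _ = refl
  weight-∅ {suc n} c {W} none with W zero | none zero
  ... | false | _ = trans (ℚₚ.+-identityˡ _) (weight-∅ (c ∘ suc) {W ∘ suc} (none ∘ suc))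
  ... | true | ¬⊤ = ⊥-elim (¬⊤ tt)

opaque
  unfolding weight ∣_∣

  weight-≤-size : ∀ {n} (c : Fin n → ℕ) {Y : Fin n → Bool} {q} →
                  (∀ {y} → y ∈ Y → zterm (c y) ℚ.≤ q) → weight c Y ℚ.≤ ∣ Y ∣ /1 ℚ.* q
  weight-≤-size {zero} c {q = q} _ = ℚₚ.≤-reflexive (sym (ℚₚ.*-zeroˡ q))
  weight-≤-size {suc n} c {Y} {q} bound = begin
    head ℚ.+ weight (c ∘ suc) (Y ∘ suc)
      ≤⟨ ℚₚ.+-mono-≤ head≤ (weight-≤-size (c ∘ suc) {Y ∘ suc} bound) ⟩
    ⟦ Y zero ⟧ /1 ℚ.* q ℚ.+ ∣ Y ∘ suc ∣ /1 ℚ.* q  ≡⟨ ℚₚ.*-distribʳ-+ q (⟦ Y zero ⟧ /1) (∣ Y ∘ suc ∣ /1) ⟨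
    (⟦ Y zero ⟧ /1 ℚ.+ ∣ Y ∘ suc ∣ /1) ℚ.* q      ≡⟨ cong (ℚ._* q) (/1-+ ⟦ Y zero ⟧ ∣ Y ∘ suc ∣) ⟨
    ∣ Y ∣ /1 ℚ.* q                                ∎
    where
    open ℚₚ.≤-Reasoning
    head : ℚ
    head = if Y zero then zterm (c zero) else 0ℚ
    head≤ : head ℚ.≤ ⟦ Y zero ⟧ /1 ℚ.* q
    head≤ with Y zero | bound {zero}
    ... | true | zterm≤q = subst (zterm (c zero) ℚ.≤_) (sym (ℚₚ.*-identityˡ q)) (zterm≤q tt)
    ... | false | _ = ℚₚ.≤-reflexive (sym (ℚₚ.*-zeroˡ q))

weight-≤-uniform : ∀ {n} (c : Fin n → ℕ) {X : Fin n → Bool} {j N} →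
                   (∀ {y} → y ∈ X → j ≤ c y) → ∣ X ∣ * 2 ≤ N * suc (2 * j) → weight c X ℚ.≤ N /1
weight-≤-uniform c {X} {j} {N} bound size≤ =
  ℚₚ.≤-trans (weight-≤-size c (λ y∈X → zterm≤ρ (bound y∈X))) (/1*ρ-≤ {∣ X ∣} {j} {N} size≤)

weight-≤-two-classes : ∀ {n} (c : Fin n → ℕ) {X : Fin n → Bool} (P : Fin n → Bool) {j₁ j₂ k₁ k₂ N} →
  (∀ {y} → y ∈ X ∩ P → j₁ ≤ c y) → (∀ {y} → y ∈ X ─ P → j₂ ≤ c y) →
  ∣ X ∩ P ∣ ≤ k₁ → ∣ X ─ P ∣ ≤ k₂ →
  k₁ * 2 * suc (2 * j₂) + k₂ * 2 * suc (2 * j₁) ≤ N * (suc (2 * j₁) * suc (2 * j₂)) →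
  weight c X ℚ.≤ N /1
weight-≤-two-classes c {X} P {j₁} {j₂} {k₁} {k₂} {N} bound₁ bound₂ size₁ size₂ cost = begin
  weight c X
    ≡⟨ weight-split c X P ⟩
  weight c (X ∩ P) ℚ.+ weight c (X ─ P)
    ≤⟨ ℚₚ.+-mono-≤ (weight-≤-size c (λ y∈ → zterm≤ρ (bound₁ y∈)))
                   (weight-≤-size c (λ y∈ → zterm≤ρ (bound₂ y∈))) ⟩
  ∣ X ∩ P ∣ /1 ℚ.* ρ j₁ ℚ.+ ∣ X ─ P ∣ /1 ℚ.* ρ j₂
    ≤⟨ /1*ρ+/1*ρ-≤ {∣ X ∩ P ∣} {j₁} {∣ X ─ P ∣} {j₂} {N} (ℕₚ.≤-trans sizes cost) ⟩
  N /1
    ∎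
  where
  open ℚₚ.≤-Reasoning
  sizes = ℕₚ.+-mono-≤ (ℕₚ.*-monoˡ-≤ (suc (2 * j₂)) (ℕₚ.*-monoˡ-≤ 2 size₁))
                      (ℕₚ.*-monoˡ-≤ (suc (2 * j₁)) (ℕₚ.*-monoˡ-≤ 2 size₂))

-- The cost estimates k₁ ρ(j₁) + k₂ ρ(j₂) ≤ N of the individual reductions, with denominators cleared.

cost-low-degree : ∀ {d m} → suc d ≤ m →
                  1 * 2 * suc (2 * m) + d * 2 * suc (2 * m) ≤ 1 * (suc (2 * m) * suc (2 * m))
cost-low-degree {d} {m} d<m = begin
  1 * 2 * suc (2 * m) + d * 2 * suc (2 * m)  ≡⟨ lhs d m ⟩
  2 * suc d * suc (2 * m)                    ≤⟨ ℕₚ.*-monoˡ-≤ _ (ℕₚ.m≤n⇒m≤1+n (ℕₚ.*-monoʳ-≤ 2 d<m)) ⟩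
  suc (2 * m) * suc (2 * m)                  ≡⟨ ℕₚ.*-identityˡ _ ⟨
  1 * (suc (2 * m) * suc (2 * m))            ∎
  where
  open ℕₚ.≤-Reasoning
  lhs : ∀ d m → 1 * 2 * suc (2 * m) + d * 2 * suc (2 * m) ≡ 2 * suc d * suc (2 * m)
  lhs = solve-∀

cost-star-m≥2 : ∀ {m} → 2 ≤ m →
                1 * 2 * suc (2 * suc m) + m * 2 * suc (2 * m) ≤ 1 * (suc (2 * m) * suc (2 * suc m))
cost-star-m≥2 {suc zero} (s≤s ())
cost-star-m≥2 {suc (suc t)} _ = ℕₚ.≤-trans (ℕₚ.m≤m+n _ (2 * t + 1)) (ℕₚ.≤-reflexive (slack t))
  where
  slack : ∀ t → 1 * 2 * suc (2 * suc (suc (suc t))) + suc (suc t) * 2 * suc (2 * suc (suc t)) + (2 * t + 1)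
              ≡ 1 * (suc (2 * suc (suc t)) * suc (2 * suc (suc (suc t))))
  slack = solve-∀

cost-star-m≡1 : ∀ {m} → m ≡ 1 → 1 * 2 * suc (2 * 3) + m * 2 * suc (2 * m) ≤ 1 * (suc (2 * m) * suc (2 * 3))
cost-star-m≡1 refl = ℕₚ.≤ᵇ⇒≤ 20 21 tt

cost-leaf-pair : 1 * 2 * suc (2 * 2) + 3 * 2 * suc (2 * 1) ≤ 2 * (suc (2 * 1) * suc (2 * 2))
cost-leaf-pair = ℕₚ.≤ᵇ⇒≤ 28 30 tt

cost-star-degree-two : 1 * 2 * suc (2 * 3) + 2 * 2 * suc (2 * 2) ≤ 1 * (suc (2 * 2) * suc (2 * 3))
cost-star-degree-two = ℕₚ.≤ᵇ⇒≤ 34 35 tt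

-- Graphs

module _ {n : ℕ} (G : Graph n) where

  adj-symmetric : ∀ {x y} → y ∈ adj G x → x ∈ adj G y
  adj-symmetric {x} {y} = subst T (adj-sym G x y)

  adj⇒≢ : ∀ {x y} → y ∈ adj G x → x ≢ y
  adj⇒≢ {x} y∼x refl = subst T (irrefl G x) y∼x

  deg : (Fin n → Bool) → Fin n → ℕ
  deg W x = ∣ W ∩ adj G x ∣

  N[_]_ : (Fin n → Bool) → Fin n → Fin n → Bool
  N[ W ] x = ⁅ x ⁆ ∪ W ∩ adj G x

  x∈N[x] : ∀ {W} x → x ∈ N[ W ] x
  x∈N[x] x = ∈∪⁺ˡ (x∈⁅x⁆ x)

  nbr∈N[x] : ∀ {W x y} → y ∈ W → y ∈ adj G x → y ∈ N[ W ] x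
  nbr∈N[x] y∈W y∼x = ∈∪⁺ʳ (∈∩⁺ y∈W y∼x)

  nbr∉⁅x⁆ : ∀ {W x y} → y ∈ W ∩ adj G x → y ∉ ⁅ x ⁆
  nbr∉⁅x⁆ y∈ y∈⁅x⁆ = adj⇒≢ (∈∩⁻ʳ y∈) (sym (x∈⁅y⁆⇒x≡y y∈⁅x⁆))

  N[x]⁻ : ∀ {W x y} → y ∈ N[ W ] x → y ≡ x ⊎ (y ∈ W × y ∈ adj G x)
  N[x]⁻ y∈N with ∈∪⁻ y∈N
  ... | inj₁ y∈⁅x⁆ = inj₁ (x∈⁅y⁆⇒x≡y y∈⁅x⁆)
  ... | inj₂ y∈nbr = inj₂ (∈∩⁻ˡ y∈nbr , ∈∩⁻ʳ y∈nbr)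

  N[x]⊆ : ∀ {W U x} → x ∈ U → (∀ {y} → y ∈ W → y ∈ adj G x → y ∈ U) → N[ W ] x ⊆ U
  N[x]⊆ x∈U nbrs∈U y∈N with N[x]⁻ y∈N
  ... | inj₁ refl = x∈U
  ... | inj₂ (y∈W , y∼x) = nbrs∈U y∈W y∼x

  N[x]-mono : ∀ {V W x} → V ⊆ W → N[ V ] x ⊆ N[ W ] x
  N[x]-mono V⊆W = N[x]⊆ (x∈N[x] _) (λ y∈V y∼x → nbr∈N[x] (V⊆W y∈V) y∼x)

  N[x]⊆W : ∀ {W x} → x ∈ W → N[ W ] x ⊆ W
  N[x]⊆W x∈W = N[x]⊆ x∈W (λ y∈W _ → y∈W)

  N[x]─⁺ : ∀ {W P x y} → y ∈ N[ W ] x → y ∉ P → y ∈ N[ W ─ P ] x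
  N[x]─⁺ y∈N y∉P with N[x]⁻ y∈N
  ... | inj₁ refl = x∈N[x] _
  ... | inj₂ (y∈W , y∼x) = nbr∈N[x] (∈─⁺ y∈W y∉P) y∼x

  ∣N[x]∣ : ∀ W x → ∣ N[ W ] x ∣ ≡ suc (deg W x)
  ∣N[x]∣ W x = trans (∣∪∣-disjoint (flip nbr∉⁅x⁆)) (cong (λ k → k + deg W x) (∣⁅x⁆∣≡1 x))

  ∣N[a]∪N[b]∣+∣N[a]∩N[b]∣ : ∀ W a b →
    ∣ N[ W ] a ∪ N[ W ] b ∣ + ∣ N[ W ] a ∩ N[ W ] b ∣ ≡ suc (deg W a) + suc (deg W b)
  ∣N[a]∪N[b]∣+∣N[a]∩N[b]∣ W a b = trans (∣∪∣+∣∩∣ _ _) (cong₂ _+_ (∣N[x]∣ W a) (∣N[x]∣ W b))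

  N[x]─⁅x⁆⊆nbrs : ∀ {W x} → N[ W ] x ─ ⁅ x ⁆ ⊆ W ∩ adj G x
  N[x]─⁅x⁆⊆nbrs {x = x} y∈ with N[x]⁻ (∈─⁻ˡ y∈)
  ... | inj₁ refl = contradiction (x∈⁅x⁆ x) (∈─⁻ʳ y∈)
  ... | inj₂ (y∈W , y∼x) = ∈∩⁺ y∈W y∼x

  nbr-of-⁅x⁆ : ∀ {W s x y} → s ∈ ⁅ x ⁆ → y ∈ W → y ∈ adj G s → y ∈ N[ W ] x
  nbr-of-⁅x⁆ s∈⁅x⁆ y∈W y∼s with x∈⁅y⁆⇒x≡y s∈⁅x⁆
  ... | refl = nbr∈N[x] y∈W y∼s

  deg-split : ∀ W P x → deg W x ≡ deg (W ∩ P) x + deg (W ─ P) x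
  deg-split W P x = trans (∣∣≡∣∩∣+∣─∣ (W ∩ adj G x) P) (cong₂ _+_ (∣∣-mono-≡ in∩ out∩) (∣∣-mono-≡ in─ out─))
    where
    ∣∣-mono-≡ : ∀ {P Q : Fin n → Bool} → P ⊆ Q → Q ⊆ P → ∣ P ∣ ≡ ∣ Q ∣
    ∣∣-mono-≡ P⊆Q Q⊆P = ℕₚ.≤-antisym (∣∣-mono P⊆Q) (∣∣-mono Q⊆P)
    in∩ : (W ∩ adj G x) ∩ P ⊆ (W ∩ P) ∩ adj G x
    in∩ y∈ = ∈∩⁺ (∈∩⁺ (∈∩⁻ˡ (∈∩⁻ˡ y∈)) (∈∩⁻ʳ y∈)) (∈∩⁻ʳ (∈∩⁻ˡ y∈))
    out∩ : (W ∩ P) ∩ adj G x ⊆ (W ∩ adj G x) ∩ P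
    out∩ y∈ = ∈∩⁺ (∈∩⁺ (∈∩⁻ˡ (∈∩⁻ˡ y∈)) (∈∩⁻ʳ y∈)) (∈∩⁻ʳ (∈∩⁻ˡ y∈))
    in─ : (W ∩ adj G x) ─ P ⊆ (W ─ P) ∩ adj G x
    in─ y∈ = ∈∩⁺ (∈─⁺ (∈∩⁻ˡ (∈─⁻ˡ y∈)) (∈─⁻ʳ y∈)) (∈∩⁻ʳ (∈─⁻ˡ y∈))
    out─ : (W ─ P) ∩ adj G x ⊆ (W ∩ adj G x) ─ P
    out─ y∈ = ∈─⁺ (∈∩⁺ (∈─⁻ˡ (∈∩⁻ˡ y∈)) (∈∩⁻ʳ y∈)) (∈─⁻ʳ (∈∩⁻ˡ y∈))

  deg-without : ∀ {W P x} → (∀ {p} → p ∈ W ∩ P → p ∉ adj G x) → deg W x ≡ deg (W ─ P) x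
  deg-without {W} {P} {x} no-nbr =
    trans (deg-split W P x) (cong (λ k → k + deg (W ─ P) x) (∣∣≡0 (λ p p∈ → no-nbr (∈∩⁻ˡ p∈) (∈∩⁻ʳ p∈))))

  Apart : (W P : Fin n → Bool) → Set
  Apart W P = ∀ {a b z} → a ∈ P → b ∈ P → a ≢ b → z ∈ N[ W ] a → z ∉ N[ W ] b

  apart⇒nbr∉ : ∀ {W P a u} → Apart W P → a ∈ P → u ∈ W → u ∈ adj G a → u ∉ P
  apart⇒nbr∉ apart a∈P u∈W u∼a u∈P = apart a∈P u∈P (adj⇒≢ u∼a) (nbr∈N[x] u∈W u∼a) (x∈N[x] _)

  apart⇒deg≤1 : ∀ {W P y} → Apart W P → y ∈ W → deg (W ∩ P) y ≤ 1
  apart⇒deg≤1 {W} {P} {y} apart y∈W = members-equal⇒∣∣≤1 same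
    where
    same : ∀ {a b} → a ∈ (W ∩ P) ∩ adj G y → b ∈ (W ∩ P) ∩ adj G y → a ≡ b
    same {a} {b} a∈ b∈ with a ≟ b
    ... | yes a≡b = a≡b
    ... | no a≢b = contradiction (nbr∈N[x] y∈W (adj-symmetric (∈∩⁻ʳ b∈)))
                     (apart (∈∩⁻ʳ (∈∩⁻ˡ a∈)) (∈∩⁻ʳ (∈∩⁻ˡ b∈)) a≢b (nbr∈N[x] y∈W (adj-symmetric (∈∩⁻ʳ a∈))))

  -- Removing a set whose members have pairwise disjoint closed neighbourhoods costs every other
  -- vertex at most one neighbour.
  min-deg-after-removal : ∀ {W P t} → Apart W P →
    (∀ {y} → y ∈ W ─ P → t ≤ deg W y) →
    (∀ {y p} → y ∈ W ─ P → p ∈ W ∩ P → y ∈ adj G p → suc t ≤ deg W y) →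
    ∀ {y} → y ∈ W ─ P → t ≤ deg (W ─ P) y
  min-deg-after-removal {W} {P} {t} apart deg≥t nbr-deg>t {y} y∈W─P
    with nonempty? ((W ∩ P) ∩ adj G y)
  ... | yes (p , p∈) = ℕₚ.≤-pred (ℕₚ.≤-trans (nbr-deg>t y∈W─P (∈∩⁻ˡ p∈) (adj-symmetric (∈∩⁻ʳ p∈)))
                        (ℕₚ.≤-trans (ℕₚ.≤-reflexive (deg-split W P y))
                          (ℕₚ.+-monoˡ-≤ (deg (W ─ P) y) (apart⇒deg≤1 apart (∈─⁻ˡ y∈W─P)))))
  ... | no none = subst (t ≤_) (deg-without (λ p∈ p∼y → none (_ , ∈∩⁺ p∈ p∼y))) (deg≥t y∈W─P)

  Independent : (Fin n → Bool) → Set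
  Independent S = ∀ {u} → u ∈ S → ∣ S ∩ adj G u ∣ ≤ 1

  independent⇒KIndependent : ∀ {S} → Independent S → KIndependent G 1 S
  independent⇒KIndependent {S} independent u u∈S =
    subst (_≤ 1) (sym (trans (count≡∣∣ _) (∣∣-cong (sym ∘ ∩-apply S (adj G u))))) (independent u∈S)

  independent-∪ : ∀ {S₁ S₂} → Independent S₁ → Independent S₂ →
                  (∀ {s t} → s ∈ S₁ → t ∈ S₂ → t ∉ adj G s) → Independent (S₁ ∪ S₂)
  independent-∪ {S₁} {S₂} ind₁ ind₂ no-edge {u} u∈ with ∈∪⁻ u∈
  ... | inj₁ u∈S₁ = ℕₚ.≤-trans (∣∣-mono only-S₁) (ind₁ u∈S₁)
    where
    only-S₁ : (S₁ ∪ S₂) ∩ adj G u ⊆ S₁ ∩ adj G u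
    only-S₁ y∈ with ∈∪⁻ (∈∩⁻ˡ y∈)
    ... | inj₁ y∈S₁ = ∈∩⁺ y∈S₁ (∈∩⁻ʳ y∈)
    ... | inj₂ y∈S₂ = contradiction (∈∩⁻ʳ y∈) (no-edge u∈S₁ y∈S₂)
  ... | inj₂ u∈S₂ = ℕₚ.≤-trans (∣∣-mono only-S₂) (ind₂ u∈S₂)
    where
    only-S₂ : (S₁ ∪ S₂) ∩ adj G u ⊆ S₂ ∩ adj G u
    only-S₂ y∈ with ∈∪⁻ (∈∩⁻ˡ y∈)
    ... | inj₁ y∈S₁ = contradiction (adj-symmetric (∈∩⁻ʳ y∈)) (no-edge y∈S₁ u∈S₂)
    ... | inj₂ y∈S₂ = ∈∩⁺ y∈S₂ (∈∩⁻ʳ y∈)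

  ⁅x⁆-independent : ∀ x → Independent ⁅ x ⁆
  ⁅x⁆-independent x _ = ⊆⁅x⁆⇒∣∣≤1 ∈∩⁻ˡ

  ⁅a⁆∪⁅b⁆-independent : ∀ a b → Independent (⁅ a ⁆ ∪ ⁅ b ⁆)
  ⁅a⁆∪⁅b⁆-independent a b {u} u∈ with ∈∪⁻ u∈
  ... | inj₁ u∈⁅a⁆ with x∈⁅y⁆⇒x≡y u∈⁅a⁆
  ...   | refl = ⊆⁅x⁆⇒∣∣≤1 λ y∈ → [ ⊥-elim ∘ nbr∉⁅x⁆ y∈ , id ]′ (∈∪⁻ (∈∩⁻ˡ y∈))
  ⁅a⁆∪⁅b⁆-independent a b {u} u∈ | inj₂ u∈⁅b⁆ with x∈⁅y⁆⇒x≡y u∈⁅b⁆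
  ...   | refl = ⊆⁅x⁆⇒∣∣≤1 λ y∈ → [ id , ⊥-elim ∘ nbr∉⁅x⁆ y∈ ]′ (∈∪⁻ (∈∩⁻ˡ y∈))

  DominatesMinDegree : (Fin n → ℕ) → Set
  DominatesMinDegree c = ∀ W → Nonempty W → ∃ λ v → v ∈ W × ∀ {u} → u ∈ W → deg W v ≤ c u

  induced : (Fin n → Bool) → Subgraph G
  induced W = record
    { inV = W
    ; inE = λ u w → W u ∧ (W w ∧ adj G u w)
    ; Esym = edge-symmetric
    ; E⊆ = λ u w p → let (u∈W , q) = to (T-∧ {W u}) p ; (w∈W , w∼u) = to (T-∧ {W w}) q in w∼u , u∈W , w∈W
    }
    where
    edge-symmetric : ∀ u w → W u ∧ (W w ∧ adj G u w) ≡ W w ∧ (W u ∧ adj G w u)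
    edge-symmetric u w rewrite adj-sym G u w with W u | W w
    ... | true | _ = refl
    ... | false | true = refl
    ... | false | false = refl

  degH-induced : ∀ {W u} → u ∈ W → degH (induced W) u ≡ deg W u
  degH-induced {W} {u} u∈W = trans (count≡∣∣ _) (∣∣-cong (λ w →
    trans (cong (λ b → b ∧ (W w ∧ adj G u w)) (to T-≡ u∈W)) (sym (∩-apply W (adj G u) w))))

  ζ-dominates-min-degree : ∀ {ζ} → (∀ v → IsZeta G v (ζ v)) → DominatesMinDegree ζ
  ζ-dominates-min-degree isζ W ne with argmin (deg W) ne
  ... | v , v∈W , v-min = v , v∈W , λ {u} u∈W → proj₂ (isζ u) (induced W) (deg W v) u∈W δ[W]≡deg-v
    where
    δ[W]≡deg-v : MinDeg (induced W) (deg W v)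
    δ[W]≡deg-v = (v , v∈W , degH-induced v∈W) ,
                 λ u u∈W → ℕₚ.≤-trans (v-min u∈W) (ℕₚ.≤-reflexive (sym (degH-induced u∈W)))

  module _ (c : Fin n → ℕ) where

    record Reduction (W : Fin n → Bool) : Set where
      field
        S X : Fin n → Bool
        S⊆X : S ⊆ X
        X⊆W : X ⊆ W
        X-nonempty : Nonempty X
        N[S]⊆X : ∀ {s y} → s ∈ S → y ∈ W → y ∈ adj G s → y ∈ X
        S-independent : Independent S
        weight≤∣S∣ : weight c X ℚ.≤ ∣ S ∣ /1

    Solution : (Fin n → Bool) → Set
    Solution W = ∃ λ S → S ⊆ W × Independent S × weight c W ℚ.≤ ∣ S ∣ /1

    empty-solution : ∀ {W} → (∀ y → y ∉ W) → Solution W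
    empty-solution none = (λ _ → false) , (λ ()) , (λ ()) ,
      ℚₚ.≤-reflexive (trans (weight-∅ c none) (cong _/1 (sym (∣∣≡0 {P = λ _ → false} (λ _ ())))))

    weight-⊆-split : ∀ {W X} → X ⊆ W → weight c W ≡ weight c X ℚ.+ weight c (W ─ X)
    weight-⊆-split {W} {X} X⊆W =
      trans (weight-split c W X) (cong (ℚ._+ weight c (W ─ X)) (weight-cong c W∩X≗X))
      where
      W∩X≗X : ∀ y → (W ∩ X) y ≡ X y
      W∩X≗X y with X y in X-y
      ... | false = trans (∩-apply W X y) (trans (cong (W y ∧_) X-y) (Boolₚ.∧-zeroʳ (W y)))
      ... | true = trans (∩-apply W X y) (cong₂ _∧_ (to T-≡ (X⊆W (subst T (sym X-y) tt))) X-y)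

    extend : ∀ {W} (r : Reduction W) → Solution (W ─ Reduction.X r) → Solution W
    extend {W} r (S′ , S′⊆W─X , S′-independent , weight≤∣S′∣) =
      S ∪ S′ , S∪S′⊆W , independent-∪ S-independent S′-independent no-edge , cost
      where
      open Reduction r
      S∪S′⊆W : S ∪ S′ ⊆ W
      S∪S′⊆W s∈ with ∈∪⁻ s∈
      ... | inj₁ s∈S = X⊆W (S⊆X s∈S)
      ... | inj₂ s∈S′ = ∈─⁻ˡ (S′⊆W─X s∈S′)
      no-edge : ∀ {s t} → s ∈ S → t ∈ S′ → t ∉ adj G s
      no-edge s∈S t∈S′ t∼s = ∈─⁻ʳ (S′⊆W─X t∈S′) (N[S]⊆X s∈S (∈─⁻ˡ (S′⊆W─X t∈S′)) t∼s)
      disjoint : ∀ {s} → s ∈ S → s ∉ S′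
      disjoint s∈S s∈S′ = ∈─⁻ʳ (S′⊆W─X s∈S′) (S⊆X s∈S)
      cost : weight c W ℚ.≤ ∣ S ∪ S′ ∣ /1
      cost = begin
        weight c W                        ≡⟨ weight-⊆-split X⊆W ⟩
        weight c X ℚ.+ weight c (W ─ X)   ≤⟨ ℚₚ.+-mono-≤ weight≤∣S∣ weight≤∣S′∣ ⟩
        ∣ S ∣ /1 ℚ.+ ∣ S′ ∣ /1            ≡⟨ /1-+ ∣ S ∣ ∣ S′ ∣ ⟨
        (∣ S ∣ + ∣ S′ ∣) /1               ≡⟨ cong _/1 (∣∪∣-disjoint disjoint) ⟨
        ∣ S ∪ S′ ∣ /1                     ∎
        where open ℚₚ.≤-Reasoning

    greedy : (∀ W → Nonempty W → Reduction W) → ∀ W → Solution W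
    greedy reduce W = go ∣ W ∣ W ℕₚ.≤-refl
      where
      go : ∀ fuel W → ∣ W ∣ ≤ fuel → Solution W
      go fuel W ∣W∣≤fuel with nonempty? W
      ... | no empty = empty-solution (λ y y∈W → empty (y , y∈W))
      ... | yes ne with fuel | reduce W ne
      ...   | zero | _ = contradiction (ℕₚ.≤-trans (∈⇒1≤∣∣ (proj₂ ne)) ∣W∣≤fuel) (λ ())
      ...   | suc fuel | r = extend r (go fuel (W ─ X) (ℕₚ.≤-pred (ℕₚ.≤-trans shrinks ∣W∣≤fuel)))
        where
        open Reduction r
        shrinks : suc ∣ W ─ X ∣ ≤ ∣ W ∣
        x∈X = proj₂ X-nonempty
        shrinks = ℕₚ.≤-trans (ℕₚ.+-monoˡ-≤ ∣ W ─ X ∣ (∈⇒1≤∣∣ (∈∩⁺ (X⊆W x∈X) x∈X)))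
                             (ℕₚ.≤-reflexive (sym (∣∣≡∣∩∣+∣─∣ W X)))

    closed-nbhd-reduction : ∀ {W v} → v ∈ W → weight c (N[ W ] v) ℚ.≤ 1 /1 → Reduction W
    closed-nbhd-reduction {W} {v} v∈W cost = record
      { S = ⁅ v ⁆
      ; X = N[ W ] v
      ; S⊆X = ∈∪⁺ˡ
      ; X⊆W = N[x]⊆W v∈W
      ; X-nonempty = v , x∈N[x] v
      ; N[S]⊆X = nbr-of-⁅x⁆
      ; S-independent = ⁅x⁆-independent v
      ; weight≤∣S∣ = subst (λ k → weight c (N[ W ] v) ℚ.≤ k /1) (sym (∣⁅x⁆∣≡1 v)) cost
      }

    pair-nbhd-reduction : ∀ {W a b} → a ∈ W → b ∈ W → a ≢ b →
                          weight c (N[ W ] a ∪ N[ W ] b) ℚ.≤ 2 /1 → Reduction W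
    pair-nbhd-reduction {W} {a} {b} a∈W b∈W a≢b cost = record
      { S = ⁅ a ⁆ ∪ ⁅ b ⁆
      ; X = N[ W ] a ∪ N[ W ] b
      ; S⊆X = λ s∈ → [ ∈∪⁺ˡ ∘ ∈∪⁺ˡ , ∈∪⁺ʳ ∘ ∈∪⁺ˡ ]′ (∈∪⁻ s∈)
      ; X⊆W = λ y∈ → [ N[x]⊆W a∈W , N[x]⊆W b∈W ]′ (∈∪⁻ y∈)
      ; X-nonempty = a , ∈∪⁺ˡ (x∈N[x] a)
      ; N[S]⊆X = λ s∈ y∈W y∼s →
          [ (λ s∈⁅a⁆ → ∈∪⁺ˡ (nbr-of-⁅x⁆ s∈⁅a⁆ y∈W y∼s)) ,
            (λ s∈⁅b⁆ → ∈∪⁺ʳ (nbr-of-⁅x⁆ s∈⁅b⁆ y∈W y∼s)) ]′ (∈∪⁻ s∈)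
      ; S-independent = ⁅a⁆∪⁅b⁆-independent a b
      ; weight≤∣S∣ = subst (λ k → weight c (N[ W ] a ∪ N[ W ] b) ℚ.≤ k /1) (sym (∣⁅x⁆∪⁅y⁆∣≡2 a≢b)) cost
      }

    isolated-reduction : ∀ {W v} → v ∈ W → deg W v ≡ 0 → Reduction W
    isolated-reduction {W} {v} v∈W deg≡0 = closed-nbhd-reduction v∈W (begin
      weight c (N[ W ] v)     ≤⟨ weight-≤-size c (λ {y} _ → zterm≤1 (c y)) ⟩
      ∣ N[ W ] v ∣ /1 ℚ.* 1ℚ  ≡⟨ ℚₚ.*-identityʳ _ ⟩
      ∣ N[ W ] v ∣ /1         ≡⟨ cong _/1 (trans (∣N[x]∣ W v) (cong suc deg≡0)) ⟩
      1 /1                    ∎)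
      where open ℚₚ.≤-Reasoning

    star-reduction : ∀ {W v j₀ j d} → v ∈ W → j₀ ≤ c v → (∀ {y} → y ∈ W ∩ adj G v → j ≤ c y) →
      deg W v ≤ d → 1 * 2 * suc (2 * j) + d * 2 * suc (2 * j₀) ≤ 1 * (suc (2 * j₀) * suc (2 * j)) →
      Reduction W
    star-reduction {W} {v} v∈W j₀≤c-v nbrs-bound deg≤d cost = closed-nbhd-reduction v∈W
      (weight-≤-two-classes c ⁅ v ⁆ {N = 1} centre-bound (nbrs-bound ∘ N[x]─⁅x⁆⊆nbrs)
        (⊆⁅x⁆⇒∣∣≤1 ∈∩⁻ʳ) (ℕₚ.≤-trans (∣∣-mono N[x]─⁅x⁆⊆nbrs) deg≤d) cost)
      where
      centre-bound : ∀ {y} → y ∈ N[ W ] v ∩ ⁅ v ⁆ → _ ≤ c y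
      centre-bound y∈ with x∈⁅y⁆⇒x≡y (∈∩⁻ʳ y∈)
      ... | refl = j₀≤c-v

    pair-reduction : ∀ {W a b j} → a ∈ W → b ∈ W → a ≢ b →
      (∀ {y} → y ∈ N[ W ] a ∪ N[ W ] b → j ≤ c y) →
      deg W a + deg W b + 1 ≤ 2 * j + ∣ N[ W ] a ∩ N[ W ] b ∣ → Reduction W
    pair-reduction {W} {a} {b} {j} a∈W b∈W a≢b bound degrees =
      pair-nbhd-reduction a∈W b∈W a≢b (weight-≤-uniform c {N = 2} bound
        (ℕₚ.≤-trans (ℕₚ.≤-reflexive (ℕₚ.*-comm ∣ N[ W ] a ∪ N[ W ] b ∣ 2)) (ℕₚ.*-monoʳ-≤ 2 ∣X∣≤)))
      where
      ∣X∣≤ : ∣ N[ W ] a ∪ N[ W ] b ∣ ≤ suc (2 * j)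
      ∣X∣≤ = ℕₚ.+-cancelʳ-≤ ∣ N[ W ] a ∩ N[ W ] b ∣ _ _ (begin
        ∣ N[ W ] a ∪ N[ W ] b ∣ + ∣ N[ W ] a ∩ N[ W ] b ∣  ≡⟨ ∣N[a]∪N[b]∣+∣N[a]∩N[b]∣ W a b ⟩
        suc (deg W a) + suc (deg W b)                      ≡⟨ suc+suc (deg W a) (deg W b) ⟩
        suc (deg W a + deg W b + 1)                        ≤⟨ s≤s degrees ⟩
        suc (2 * j) + ∣ N[ W ] a ∩ N[ W ] b ∣              ∎)
        where
        open ℕₚ.≤-Reasoning
        suc+suc : ∀ x y → suc x + suc y ≡ suc (x + y + 1)
        suc+suc = solve-∀

    pair-reduction-shared : ∀ {W a b j} → a ∈ W → b ∈ W → a ≢ b →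
      (∀ {y} → y ∈ N[ W ] a ∪ N[ W ] b → j ≤ c y) →
      deg W a ≤ j → deg W b ≤ j → Nonempty (N[ W ] a ∩ N[ W ] b) → Reduction W
    pair-reduction-shared {W} {a} {b} {j} a∈W b∈W a≢b bound deg-a deg-b (_ , z∈) =
      pair-reduction a∈W b∈W a≢b bound (begin
        deg W a + deg W b + 1                  ≤⟨ ℕₚ.+-mono-≤ (ℕₚ.+-mono-≤ deg-a deg-b) (∈⇒1≤∣∣ z∈) ⟩
        j + j + ∣ N[ W ] a ∩ N[ W ] b ∣        ≡⟨ cong (λ k → k + ∣ N[ W ] a ∩ N[ W ] b ∣) (j+j≡2*j j) ⟩
        2 * j + ∣ N[ W ] a ∩ N[ W ] b ∣        ∎)
      where
      open ℕₚ.≤-Reasoning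
      j+j≡2*j : ∀ j → j + j ≡ 2 * j
      j+j≡2*j = solve-∀

    pair-reduction-adjacent : ∀ {W a b j} → a ∈ W → b ∈ W → b ∈ adj G a →
      (∀ {y} → y ∈ N[ W ] a ∪ N[ W ] b → j ≤ c y) →
      deg W a ≤ j → deg W b ≤ suc j → Reduction W
    pair-reduction-adjacent {W} {a} {b} {j} a∈W b∈W b∼a bound deg-a deg-b =
      pair-reduction a∈W b∈W (adj⇒≢ b∼a) bound (begin
        deg W a + deg W b + 1                  ≤⟨ ℕₚ.+-monoˡ-≤ 1 (ℕₚ.+-mono-≤ deg-a deg-b) ⟩
        j + suc j + 1                          ≡⟨ j+[j+1]+1≡2*j+2 j ⟩
        2 * j + 2                              ≤⟨ ℕₚ.+-monoʳ-≤ (2 * j) a,b∈N[a]∩N[b] ⟩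
        2 * j + ∣ N[ W ] a ∩ N[ W ] b ∣        ∎)
      where
      open ℕₚ.≤-Reasoning
      j+[j+1]+1≡2*j+2 : ∀ j → j + suc j + 1 ≡ 2 * j + 2
      j+[j+1]+1≡2*j+2 = solve-∀
      a,b∈N[a]∩N[b] : 2 ≤ ∣ N[ W ] a ∩ N[ W ] b ∣
      a,b∈N[a]∩N[b] = ∈⇒2≤∣∣ (adj⇒≢ b∼a) (∈∩⁺ (x∈N[x] a) (nbr∈N[x] a∈W (adj-symmetric b∼a)))
                                         (∈∩⁺ (nbr∈N[x] b∈W b∼a) (x∈N[x] b))

    module _ (dominated : DominatesMinDegree c) where

      -- Reached from MinimumDegree.Separated when m = 1 and G[W ─ A] has minimum degree 2.
      module LeafCase (W A : Fin n → Bool) (A⊆W : A ⊆ W) (A-apart : Apart W A)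
                      (A-leaf : ∀ {a} → a ∈ A → deg W a ≤ 1)
                      (c≥1 : ∀ {y} → y ∈ W → 1 ≤ c y) (c≥2 : ∀ {y} → y ∈ W ─ A → 2 ≤ c y)
                      {y₀} (y₀∈W′ : y₀ ∈ W ─ A) (deg-y₀ : deg (W ─ A) y₀ ≡ 2) where

        W′ : Fin n → Bool
        W′ = W ─ A

        B : Fin n → Bool
        B = W′ ∩ (λ x → deg W′ x ≤ᵇ 2)

        B⊆W′ : B ⊆ W′
        B⊆W′ = ∈∩⁻ˡ

        deg′-B : ∀ {x} → x ∈ B → deg W′ x ≤ 2
        deg′-B x∈B = ℕₚ.≤ᵇ⇒≤ _ 2 (∈∩⁻ʳ x∈B)

        leaf-pair-reduction : ∀ {a x} → a ∈ A → x ∈ W′ → deg W′ x ≤ 2 →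
          (∀ {z} → z ∈ W → z ∈ adj G a → z ∈ N[ W ] x) →
          ∣ (N[ W ] a ∪ N[ W ] x) ∩ A ∣ ≤ 1 → Reduction W
        leaf-pair-reduction {a} {x} a∈A x∈W′ deg-x N[a]⊆N[x] ∣X∩A∣≤1 =
          pair-nbhd-reduction (A⊆W a∈A) (∈─⁻ˡ x∈W′) a≢x
            (weight-≤-two-classes c A {N = 2} (λ y∈ → c≥1 (X⊆W (∈∩⁻ˡ y∈)))
              (λ y∈ → c≥2 (∈─⁺ (X⊆W (∈─⁻ˡ y∈)) (∈─⁻ʳ y∈))) ∣X∩A∣≤1 ∣X─A∣≤3 cost-leaf-pair)
          where
          a≢x : a ≢ x
          a≢x refl = ∈─⁻ʳ x∈W′ a∈A
          X⊆W : N[ W ] a ∪ N[ W ] x ⊆ W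
          X⊆W y∈ = [ N[x]⊆W (A⊆W a∈A) , N[x]⊆W (∈─⁻ˡ x∈W′) ]′ (∈∪⁻ y∈)
          X─A⊆N′[x] : (N[ W ] a ∪ N[ W ] x) ─ A ⊆ N[ W′ ] x
          X─A⊆N′[x] y∈ with ∈∪⁻ (∈─⁻ˡ y∈)
          ... | inj₂ y∈N[x] = N[x]─⁺ y∈N[x] (∈─⁻ʳ y∈)
          ... | inj₁ y∈N[a] with N[x]⁻ y∈N[a]
          ...   | inj₁ refl = contradiction a∈A (∈─⁻ʳ y∈)
          ...   | inj₂ (y∈W , y∼a) = N[x]─⁺ (N[a]⊆N[x] y∈W y∼a) (∈─⁻ʳ y∈)
          ∣X─A∣≤3 : ∣ (N[ W ] a ∪ N[ W ] x) ─ A ∣ ≤ 3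
          ∣X─A∣≤3 = ℕₚ.≤-trans (∣∣-mono X─A⊆N′[x]) (ℕₚ.≤-trans (ℕₚ.≤-reflexive (∣N[x]∣ W′ x)) (s≤s deg-x))

        only-nbr-of-leaf : ∀ {a z w} → a ∈ A → z ∈ W → z ∈ adj G a → w ∈ W → w ∈ adj G a → z ≡ w
        only-nbr-of-leaf a∈A z∈W z∼a w∈W w∼a = ∣∣≤1⇒≡ (A-leaf a∈A) (∈∩⁺ z∈W z∼a) (∈∩⁺ w∈W w∼a)

        LeafNeighbour : Set
        LeafNeighbour = ∃₂ λ x a → x ∈ B × a ∈ A × a ∈ adj G x

        leaf-neighbour? : Dec LeafNeighbour
        leaf-neighbour? = any? λ x → any? λ a → T? (B x) ×-dec T? (A a) ×-dec T? (adj G x a)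

        leaf-neighbour-reduction : LeafNeighbour → Reduction W
        leaf-neighbour-reduction (x , a , x∈B , a∈A , a∼x) =
          leaf-pair-reduction a∈A x∈W′ (deg′-B x∈B) N[a]⊆N[x]
            (ℕₚ.≤-trans (∣∣-mono X∩A⊆) (apart⇒deg≤1 A-apart x∈W))
          where
          x∈W′ = B⊆W′ x∈B
          x∈W = ∈─⁻ˡ x∈W′
          N[a]⊆N[x] : ∀ {z} → z ∈ W → z ∈ adj G a → z ∈ N[ W ] x
          N[a]⊆N[x] z∈W z∼a with only-nbr-of-leaf a∈A z∈W z∼a x∈W (adj-symmetric a∼x)
          ... | refl = x∈N[x] x
          X∩A⊆ : (N[ W ] a ∪ N[ W ] x) ∩ A ⊆ (W ∩ A) ∩ adj G x
          X∩A⊆ y∈ with ∈∪⁻ (∈∩⁻ˡ y∈)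
          ... | inj₁ y∈N[a] with N[x]⁻ y∈N[a]
          ...   | inj₁ refl = ∈∩⁺ (∈∩⁺ (A⊆W a∈A) a∈A) a∼x
          ...   | inj₂ (y∈W , y∼a) with only-nbr-of-leaf a∈A y∈W y∼a x∈W (adj-symmetric a∼x)
          ...     | refl = contradiction (∈∩⁻ʳ y∈) (∈─⁻ʳ x∈W′)
          X∩A⊆ y∈ | inj₂ y∈N[x] with N[x]⁻ y∈N[x]
          ...   | inj₁ refl = contradiction (∈∩⁻ʳ y∈) (∈─⁻ʳ x∈W′)
          ...   | inj₂ (y∈W , y∼x) = ∈∩⁺ (∈∩⁺ y∈W (∈∩⁻ʳ y∈)) y∼x

        LeafAtDistanceTwo : Set
        LeafAtDistanceTwo = ∃ λ x → ∃₂ λ w a → x ∈ B × w ∈ W′ × w ∈ adj G x × a ∈ A × a ∈ adj G w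

        leaf-at-distance-two? : Dec LeafAtDistanceTwo
        leaf-at-distance-two? = any? λ x → any? λ w → any? λ a →
          T? (B x) ×-dec T? (W′ w) ×-dec T? (adj G x w) ×-dec T? (A a) ×-dec T? (adj G w a)

        leaf-at-distance-two-reduction : ¬ LeafNeighbour → LeafAtDistanceTwo → Reduction W
        leaf-at-distance-two-reduction ¬leaf-nbr (x , w , a , x∈B , w∈W′ , w∼x , a∈A , a∼w) =
          leaf-pair-reduction a∈A x∈W′ (deg′-B x∈B) N[a]⊆N[x] (⊆⁅x⁆⇒∣∣≤1 X∩A⊆⁅a⁆)
          where
          x∈W′ = B⊆W′ x∈B
          w∈W = ∈─⁻ˡ w∈W′
          N[a]⊆N[x] : ∀ {z} → z ∈ W → z ∈ adj G a → z ∈ N[ W ] x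
          N[a]⊆N[x] z∈W z∼a with only-nbr-of-leaf a∈A z∈W z∼a w∈W (adj-symmetric a∼w)
          ... | refl = nbr∈N[x] w∈W w∼x
          X∩A⊆⁅a⁆ : (N[ W ] a ∪ N[ W ] x) ∩ A ⊆ ⁅ a ⁆
          X∩A⊆⁅a⁆ y∈ with ∈∪⁻ (∈∩⁻ˡ y∈)
          ... | inj₁ y∈N[a] with N[x]⁻ y∈N[a]
          ...   | inj₁ refl = x∈⁅x⁆ a
          ...   | inj₂ (y∈W , y∼a) with only-nbr-of-leaf a∈A y∈W y∼a w∈W (adj-symmetric a∼w)
          ...     | refl = contradiction (∈∩⁻ʳ y∈) (∈─⁻ʳ w∈W′)
          X∩A⊆⁅a⁆ y∈ | inj₂ y∈N[x] with N[x]⁻ y∈N[x]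
          ...   | inj₁ refl = contradiction (∈∩⁻ʳ y∈) (∈─⁻ʳ x∈W′)
          ...   | inj₂ (_ , y∼x) = contradiction (x , _ , x∈B , ∈∩⁻ʳ y∈ , y∼x) ¬leaf-nbr

        CloseLowPair : Set
        CloseLowPair = ∃₂ λ x x′ → x ∈ B × x′ ∈ B × x ≢ x′ × Nonempty (N[ W ] x ∩ N[ W ] x′)

        close-low-pair? : Dec CloseLowPair
        close-low-pair? = any? λ x → any? λ x′ →
          T? (B x) ×-dec T? (B x′) ×-dec ¬? (x ≟ x′) ×-dec nonempty? (N[ W ] x ∩ N[ W ] x′)

        LowNeighbour : Set
        LowNeighbour = ∃₂ λ x z → x ∈ B × z ∈ W′ × z ∈ adj G x × deg W′ z ≤ 3

        low-neighbour? : Dec LowNeighbour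
        low-neighbour? = any? λ x → any? λ z →
          T? (B x) ×-dec T? (W′ z) ×-dec T? (adj G x z) ×-dec (deg W′ z ℕ.≤? 3)

        module NoLeafNeighbour (¬leaf-nbr : ¬ LeafNeighbour) where

          no-leaf-nbr⇒N[x]⊆W′ : ∀ {x} → x ∈ W′ → (∀ {a} → a ∈ A → a ∉ adj G x) → N[ W ] x ⊆ W′
          no-leaf-nbr⇒N[x]⊆W′ x∈W′ no-leaf = N[x]⊆ x∈W′ (λ y∈W y∼x → ∈─⁺ y∈W (λ y∈A → no-leaf y∈A y∼x))

          no-leaf-nbr⇒deg≤ : ∀ {x k} → deg W′ x ≤ k → (∀ {a} → a ∈ A → a ∉ adj G x) → deg W x ≤ k
          no-leaf-nbr⇒deg≤ deg′≤k no-leaf =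
            subst (_≤ _) (sym (deg-without (λ a∈ → no-leaf (∈∩⁻ʳ a∈)))) deg′≤k

          B-no-leaf : ∀ {x a} → x ∈ B → a ∈ A → a ∉ adj G x
          B-no-leaf x∈B a∈A a∼x = ¬leaf-nbr (_ , _ , x∈B , a∈A , a∼x)

          close-low-pair-reduction : CloseLowPair → Reduction W
          close-low-pair-reduction (x , x′ , x∈B , x′∈B , x≢x′ , shared) =
            pair-reduction-shared (∈─⁻ˡ (B⊆W′ x∈B)) (∈─⁻ˡ (B⊆W′ x′∈B)) x≢x′
              (λ y∈ → c≥2 ([ N[B]⊆W′ x∈B , N[B]⊆W′ x′∈B ]′ (∈∪⁻ y∈)))
              (no-leaf-nbr⇒deg≤ (deg′-B x∈B) (B-no-leaf x∈B))
              (no-leaf-nbr⇒deg≤ (deg′-B x′∈B) (B-no-leaf x′∈B))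
              shared
            where
            N[B]⊆W′ : ∀ {x} → x ∈ B → N[ W ] x ⊆ W′
            N[B]⊆W′ x∈B = no-leaf-nbr⇒N[x]⊆W′ (B⊆W′ x∈B) (B-no-leaf x∈B)

          low-neighbour-reduction : ¬ LeafAtDistanceTwo → LowNeighbour → Reduction W
          low-neighbour-reduction ¬leaf-dist2 (x , z , x∈B , z∈W′ , z∼x , deg′-z) =
            pair-reduction-adjacent (∈─⁻ˡ (B⊆W′ x∈B)) (∈─⁻ˡ z∈W′) z∼x
              (λ y∈ → c≥2 ([ no-leaf-nbr⇒N[x]⊆W′ (B⊆W′ x∈B) (B-no-leaf x∈B) ,
                             no-leaf-nbr⇒N[x]⊆W′ z∈W′ z-no-leaf ]′ (∈∪⁻ y∈)))
              (no-leaf-nbr⇒deg≤ (deg′-B x∈B) (B-no-leaf x∈B)) (no-leaf-nbr⇒deg≤ deg′-z z-no-leaf)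
            where
            z-no-leaf : ∀ {a} → a ∈ A → a ∉ adj G z
            z-no-leaf a∈A a∼z = ¬leaf-dist2 (x , z , _ , x∈B , z∈W′ , z∼x , a∈A , a∼z)

          module Exhausted (¬close : ¬ CloseLowPair) (¬low : ¬ LowNeighbour) where

            B-apart : Apart W′ B
            B-apart x∈B x′∈B x≢x′ z∈N[x] z∈N[x′] =
              ¬close (_ , _ , x∈B , x′∈B , x≢x′ , _ , ∈∩⁺ (N[x]-mono ∈─⁻ˡ z∈N[x]) (N[x]-mono ∈─⁻ˡ z∈N[x′]))

            W″ : Fin n → Bool
            W″ = W′ ─ B

            deg″≥3 : ∀ {y} → y ∈ W″ → 3 ≤ deg W″ y
            deg″≥3 = min-deg-after-removal B-apart not-low heavy
              where
              not-low : ∀ {y} → y ∈ W′ ─ B → 3 ≤ deg W′ y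
              not-low y∈ = ℕₚ.≰⇒> (λ deg≤2 → ∈─⁻ʳ y∈ (∈∩⁺ (∈─⁻ˡ y∈) (ℕₚ.≤⇒≤ᵇ deg≤2)))
              heavy : ∀ {y p} → y ∈ W′ ─ B → p ∈ W′ ∩ B → y ∈ adj G p → 4 ≤ deg W′ y
              heavy y∈ p∈ y∼p = ℕₚ.≰⇒> (λ deg≤3 → ¬low (_ , _ , ∈∩⁻ʳ p∈ , ∈─⁻ˡ y∈ , y∼p , deg≤3))

            y₀∈B : y₀ ∈ B
            y₀∈B = ∈∩⁺ y₀∈W′ (ℕₚ.≤⇒≤ᵇ (ℕₚ.≤-reflexive deg-y₀))

            nbr-y₀∈W″ : ∀ {y} → y ∈ W ∩ adj G y₀ → y ∈ W″
            nbr-y₀∈W″ y∈ = ∈─⁺ y∈W′ (apart⇒nbr∉ B-apart y₀∈B y∈W′ (∈∩⁻ʳ y∈))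
              where
              y∈W′ = ∈─⁺ (∈∩⁻ˡ y∈) (λ y∈A → B-no-leaf y₀∈B y∈A (∈∩⁻ʳ y∈))

            W″-nonempty : Nonempty W″
            W″-nonempty with 1≤∣∣⇒Nonempty (ℕₚ.≤-trans (s≤s z≤n) (ℕₚ.≤-reflexive (sym deg-y₀)))
            ... | u , u∈ = u , nbr-y₀∈W″ (∈∩⁺ (∈─⁻ˡ (∈∩⁻ˡ u∈)) (∈∩⁻ʳ u∈))

            c≥3 : ∀ {y} → y ∈ W″ → 3 ≤ c y
            c≥3 with dominated W″ W″-nonempty
            ... | y₁ , y₁∈W″ , y₁-dominated = λ y∈W″ → ℕₚ.≤-trans (deg″≥3 y₁∈W″) (y₁-dominated y∈W″)

            reduction : Reduction W
            reduction = star-reduction (∈─⁻ˡ y₀∈W′) (c≥2 y₀∈W′) (c≥3 ∘ nbr-y₀∈W″)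
              (no-leaf-nbr⇒deg≤ (ℕₚ.≤-reflexive deg-y₀) (B-no-leaf y₀∈B)) cost-star-degree-two

        reduction : Reduction W
        reduction with leaf-neighbour?
        ... | yes leaf-nbr = leaf-neighbour-reduction leaf-nbr
        ... | no ¬leaf-nbr with leaf-at-distance-two?
        ...   | yes leaf-dist2 = leaf-at-distance-two-reduction ¬leaf-nbr leaf-dist2
        ...   | no ¬leaf-dist2 with close-low-pair? | low-neighbour?
        ...     | yes close | _ = NoLeafNeighbour.close-low-pair-reduction ¬leaf-nbr close
        ...     | no _ | yes low = NoLeafNeighbour.low-neighbour-reduction ¬leaf-nbr ¬leaf-dist2 low
        ...     | no ¬close | no ¬low = NoLeafNeighbour.Exhausted.reduction ¬leaf-nbr ¬close ¬low

      module MinimumDegree (W : Fin n → Bool) (m : ℕ)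
          (c≥m : ∀ {y} → y ∈ W → m ≤ c y) {v} (v∈W : v ∈ W) (deg-v : deg W v ≡ m) (m≥1 : 1 ≤ m) where

        A : Fin n → Bool
        A = W ∩ (λ y → deg W y ≤ᵇ m)

        A⊆W : A ⊆ W
        A⊆W = ∈∩⁻ˡ

        deg-A : ∀ {a} → a ∈ A → deg W a ≤ m
        deg-A a∈A = ℕₚ.≤ᵇ⇒≤ _ _ (∈∩⁻ʳ a∈A)

        v∈A : v ∈ A
        v∈A = ∈∩⁺ v∈W (ℕₚ.≤⇒≤ᵇ (ℕₚ.≤-reflexive deg-v))

        c≥m-on : ∀ {a b} → a ∈ W → b ∈ W → ∀ {y} → y ∈ N[ W ] a ∪ N[ W ] b → m ≤ c y
        c≥m-on a∈W b∈W y∈ = c≥m ([ N[x]⊆W a∈W , N[x]⊆W b∈W ]′ (∈∪⁻ y∈))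

        SharedNeighbour : Set
        SharedNeighbour = ∃₂ λ a b → a ∈ A × b ∈ A × a ≢ b × Nonempty (N[ W ] a ∩ N[ W ] b)

        shared-neighbour? : Dec SharedNeighbour
        shared-neighbour? = any? λ a → any? λ b →
          T? (A a) ×-dec T? (A b) ×-dec ¬? (a ≟ b) ×-dec nonempty? (N[ W ] a ∩ N[ W ] b)

        LightNeighbour : Set
        LightNeighbour = ∃₂ λ a u → a ∈ A × u ∈ W × u ∈ adj G a × deg W u ≤ suc m

        light-neighbour? : Dec LightNeighbour
        light-neighbour? = any? λ a → any? λ u →
          T? (A a) ×-dec T? (W u) ×-dec T? (adj G a u) ×-dec (deg W u ℕ.≤? suc m)

        shared-neighbour-reduction : SharedNeighbour → Reduction W
        shared-neighbour-reduction (a , b , a∈A , b∈A , a≢b , shared) =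
          pair-reduction-shared (A⊆W a∈A) (A⊆W b∈A) a≢b (c≥m-on (A⊆W a∈A) (A⊆W b∈A))
            (deg-A a∈A) (deg-A b∈A) shared

        light-neighbour-reduction : LightNeighbour → Reduction W
        light-neighbour-reduction (a , u , a∈A , u∈W , u∼a , deg-u) =
          pair-reduction-adjacent (A⊆W a∈A) u∈W u∼a (c≥m-on (A⊆W a∈A) u∈W) (deg-A a∈A) deg-u

        module Separated (¬shared : ¬ SharedNeighbour) (¬light : ¬ LightNeighbour) where

          A-apart : Apart W A
          A-apart a∈A b∈A a≢b z∈N[a] z∈N[b] = ¬shared (_ , _ , a∈A , b∈A , a≢b , _ , ∈∩⁺ z∈N[a] z∈N[b])

          W′ : Fin n → Bool
          W′ = W ─ A

          deg′>m : ∀ {y} → y ∈ W′ → suc m ≤ deg W′ y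
          deg′>m = min-deg-after-removal A-apart not-min heavy
            where
            not-min : ∀ {y} → y ∈ W ─ A → suc m ≤ deg W y
            not-min y∈ = ℕₚ.≰⇒> (λ deg≤m → ∈─⁻ʳ y∈ (∈∩⁺ (∈─⁻ˡ y∈) (ℕₚ.≤⇒≤ᵇ deg≤m)))
            heavy : ∀ {y p} → y ∈ W ─ A → p ∈ W ∩ A → y ∈ adj G p → suc (suc m) ≤ deg W y
            heavy y∈ p∈ y∼p = ℕₚ.≰⇒> (λ deg≤m+1 → ¬light (_ , _ , ∈∩⁻ʳ p∈ , ∈─⁻ˡ y∈ , y∼p , deg≤m+1))

          nbr-v∈W′ : ∀ {y} → y ∈ W ∩ adj G v → y ∈ W′
          nbr-v∈W′ y∈ = ∈─⁺ (∈∩⁻ˡ y∈) (apart⇒nbr∉ A-apart v∈A (∈∩⁻ˡ y∈) (∈∩⁻ʳ y∈))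

          W′-nonempty : Nonempty W′
          W′-nonempty with 1≤∣∣⇒Nonempty (subst (1 ≤_) (sym deg-v) m≥1)
          ... | u , u∈ = u , nbr-v∈W′ u∈

          lowest : ∃ λ y₀ → y₀ ∈ W′ × ∀ {u} → u ∈ W′ → deg W′ y₀ ≤ c u
          lowest = dominated W′ W′-nonempty

          y₀ : Fin n
          y₀ = proj₁ lowest

          k : ℕ
          k = deg W′ y₀

          k>m : suc m ≤ k
          k>m = deg′>m (proj₁ (proj₂ lowest))

          c≥k : ∀ {y} → y ∈ W′ → k ≤ c y
          c≥k = proj₂ (proj₂ lowest)

          star-at-v : ∀ {j} → j ≤ k →
            1 * 2 * suc (2 * j) + m * 2 * suc (2 * m) ≤ 1 * (suc (2 * m) * suc (2 * j)) → Reduction W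
          star-at-v j≤k = star-reduction v∈W (c≥m v∈W) (λ y∈ → ℕₚ.≤-trans j≤k (c≥k (nbr-v∈W′ y∈)))
                                         (ℕₚ.≤-reflexive deg-v)

          m≡1 : ¬ 2 ≤ m → m ≡ 1
          m≡1 m≱2 = ℕₚ.≤-antisym (ℕₚ.≤-pred (ℕₚ.≰⇒> m≱2)) m≥1

          reduction : Reduction W
          reduction with 2 ℕ.≤? m | 3 ℕ.≤? k
          ... | yes m≥2 | _ = star-at-v k>m (cost-star-m≥2 m≥2)
          ... | no m≱2 | yes k≥3 = star-at-v k≥3 (cost-star-m≡1 (m≡1 m≱2))
          ... | no m≱2 | no k≱3 =
            LeafCase.reduction W A A⊆W A-apart (λ a∈A → subst (deg W _ ≤_) (m≡1 m≱2) (deg-A a∈A))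
              (λ y∈W → subst (_≤ c _) (m≡1 m≱2) (c≥m y∈W)) (λ y∈W′ → ℕₚ.≤-trans k≥2 (c≥k y∈W′))
              (proj₁ (proj₂ lowest)) k≡2
            where
            k≥2 : 2 ≤ k
            k≥2 = subst (λ m → suc m ≤ k) (m≡1 m≱2) k>m
            k≡2 : k ≡ 2
            k≡2 = ℕₚ.≤-antisym (ℕₚ.≤-pred (ℕₚ.≰⇒> k≱3)) k≥2

        reduction : Reduction W
        reduction with shared-neighbour? | light-neighbour?
        ... | yes shared | _ = shared-neighbour-reduction shared
        ... | no _ | yes light = light-neighbour-reduction light
        ... | no ¬shared | no ¬light = Separated.reduction ¬shared ¬light

      reduce : ∀ W → Nonempty W → Reduction W
      reduce W ne with dominated W ne
      ... | v , v∈W , v-dominated with deg W v ℕ.≟ 0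
      ...   | yes deg≡0 = isolated-reduction v∈W deg≡0
      ...   | no deg≢0 with argmin c ne
      ...     | x , x∈W , x-min with any? (λ y → T? (W y) ×-dec (suc (deg W y) ℕ.≤? c x))
      ...       | yes (y , y∈W , deg<m) =
                    star-reduction y∈W (x-min y∈W) (x-min ∘ ∈∩⁻ˡ) ℕₚ.≤-refl (cost-low-degree deg<m)
      ...       | no ¬low = MinimumDegree.reduction W (c x) x-min v∈W deg-v m≥1
        where
        deg≥m : ∀ {y} → y ∈ W → c x ≤ deg W y
        deg≥m y∈W = ℕₚ.≤-pred (ℕₚ.≰⇒> (λ deg<m → ¬low (_ , y∈W , deg<m)))
        deg-v : deg W v ≡ c x
        deg-v = ℕₚ.≤-antisym (v-dominated x∈W) (deg≥m v∈W)
        m≥1 : 1 ≤ c x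
        m≥1 = subst (1 ≤_) deg-v (ℕₚ.n≢0⇒n>0 deg≢0)

theorem5 : (n : ℕ) → 1 ≤ n → (G : Graph n) → (ζ : Fin n → ℕ)
    → (∀ v → IsZeta G v (ζ v))
    → Σ (Fin n → Bool) λ S → KIndependent G 1 S × (Z2 ζ ℚ.≤ (+ count S / 1))
theorem5 n _ G ζ isζ with greedy G ζ (reduce G ζ (ζ-dominates-min-degree G isζ)) (λ _ → true)
... | S , _ , S-independent , weight≤∣S∣ =
  S , independent⇒KIndependent G S-independent ,
  subst₂ ℚ._≤_ (sym (Z2≡weight ζ)) (cong _/1 (sym (count≡∣∣ S))) weight≤∣S∣
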